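{- Let $\mathbb{F}$ be a field of characteristic zero, let $\mathfrak{X}=(\Omega,\mathcal{C})$ be a symmetric Jordan configuration and let $\mathcal{A}=\mathbb{F}\langle\underline{C}:C\in\mathcal{C}\rangle\subseteq M_\Omega(\mathbb{F})$ be its adjacency algebra. The following are equivalent: (a) $\mathfrak{X}$ is regular; (b) $\mathfrak{X}$ is homogeneous, i.e. $1_\Omega\in\mathcal{C}$; (c) $\mathcal{A}\cdot J_\Omega=\mathbb{F}\langle J_\Omega\rangle$; (d) $\mathcal{A}\star J_\Omega=\mathbb{F}\langle J_\Omega\rangle$.
   Context: $J_\Omega$ is the all-one matrix, $A\star B=\frac12(AB+BA)$, $\mathcal{A}\cdot J_\Omega=\{AJ_\Omega:A\in\mathcal{A}\}$, $\mathcal{A}\star J_\Omega=\{A\star J_\Omega:A\in\mathcal{A}\}$. For $R\subseteq\Omega^2$: $R(\alpha)=\{\beta:(\alpha,\beta)\in R\}$, $R^\top$ the transpose, $\underline{R}$ the adjacency matrix. A rainbow is a partition $\mathcal{C}$ of $\Omega^2$ such that $1_\Omega$ is a union of classes and $C^\top\in\mathcal{C}$ for all $C\in\mathcal{C}$. A Jordan configuration is a rainbow such that for all $C,D\in\mathcal{C}$ and all pairs $(\alpha,\beta),(\alpha',\beta')$ in the same class, $|C(\alpha)\cap D^\top(\beta)|+|D(\alpha)\cap C^\top(\beta)|=|C(\alpha')\cap D^\top(\beta')|+|D(\alpha')\cap C^\top(\beta')|$. It is symmetric if $C^\top=C$ for all $C\in\mathcal{C}$, and regular if $|C(\alpha)|$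 is independent of $\alpha$ for every $C\in\mathcal{C}$. -}

module Defs where

open import Level using (Level; _⊔_)
open import Data.Nat using (ℕ; zero; suc) renaming (_+_ to _+ℕ_)
open import Data.Fin using (Fin; zero; suc) renaming (_≟_ to _≟ᶠ_)
open import Data.Bool using (Bool; true; false; if_then_else_; _∧_)
open import Data.Product using (Σ; ∃; _×_; _,_)
open import Relation.Nullary using (¬_)
open import Relation.Nullary.Decidable using (⌊_⌋)
open import Relation.Binary.PropositionalEquality using (_≡_)
open import Function.Bundles using (_⇔_)
open import Algebra.Bundles using (CommutativeRing)

record Field (c ℓ : Level) : Set (Level.suc (c ⊔ ℓ)) where
  field
    commutativeRing : CommutativeRing c ℓ
  open CommutativeRing commutativeRing public
  field
    _⁻¹      : Carrier → Carrier
    1≉0      : ¬ (1# ≈ 0#)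
    inverseʳ : ∀ x → ¬ (x ≈ 0#) → (x * (x ⁻¹)) ≈ 1#

module FieldDefs {c ℓ} (F : Field c ℓ) where
  open Field F using (Carrier; _≈_; _+_; _*_; 0#; 1#; _⁻¹)

  fromℕ : ℕ → Carrier
  fromℕ zero    = 0#
  fromℕ (suc k) = 1# + fromℕ k

  CharZero : Set ℓ
  CharZero = ∀ (k : ℕ) → ¬ (fromℕ (suc k) ≈ 0#)

  Σᶠ : ∀ {k} → (Fin k → Carrier) → Carrier
  Σᶠ {zero}  f = 0#
  Σᶠ {suc k} f = f zero + Σᶠ (λ i → f (suc i))

  Mat : ℕ → Set c
  Mat n = Fin n → Fin n → Carrier

  _≈ₘ_ : ∀ {n} → Mat n → Mat n → Set ℓ
  A ≈ₘ B = ∀ α β → A α β ≈ B α β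

  _·ₘ_ : ∀ {n} → Mat n → Mat n → Mat n
  (A ·ₘ B) α β = Σᶠ (λ γ → A α γ * B γ β)

  _+ₘ_ : ∀ {n} → Mat n → Mat n → Mat n
  (A +ₘ B) α β = A α β + B α β

  _•ₘ_ : ∀ {n} → Carrier → Mat n → Mat n
  (x •ₘ A) α β = x * A α β

  J : ∀ {n} → Mat n
  J α β = 1#

  _⋆_ : ∀ {n} → Mat n → Mat n → Mat n
  A ⋆ B = ((1# + 1#) ⁻¹) •ₘ ((A ·ₘ B) +ₘ (B ·ₘ A))

  _≐_ : ∀ {n} → (Mat n → Set (c ⊔ ℓ)) → (Mat n → Set (c ⊔ ℓ)) → Set (c ⊔ ℓ)
  P ≐ Q = ∀ M → P M ⇔ Q M

  SpanJ : ∀ {n} → Mat n → Set (c ⊔ ℓ)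
  SpanJ {n} M = ∃ λ (x : Carrier) → M ≈ₘ (x •ₘ J {n})

  module _ {n m : ℕ} (col : Fin n → Fin n → Fin m) where
    adj : Fin m → Mat n
    adj i α β = if ⌊ col α β ≟ᶠ i ⌋ then 1# else 0#

    -- membership in the adjacency algebra 𝒜 = F⟨ C_i : i ⟩ (linear span)
    InAlg : Mat n → Set (c ⊔ ℓ)
    InAlg A = ∃ λ (a : Fin m → Carrier) →
                A ≈ₘ (λ α β → Σᶠ (λ i → a i * adj i α β))

    AlgTimesJ : Mat n → Set (c ⊔ ℓ)
    AlgTimesJ M = ∃ λ (A : Mat n) → InAlg A × (M ≈ₘ (A ·ₘ J))

    AlgStarJ : Mat n → Set (c ⊔ ℓ)
    AlgStarJ M = ∃ λ (A : Mat n) → InAlg A × (M ≈ₘ (A ⋆ J))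

-- Colourings / configurations.
-- A partition 𝒞 of Ω² (Ω = Fin n) into m classes is encoded by a
-- surjective colouring col : Ω → Ω → Fin m; class i is
-- C_i = { (α,β) : col α β ≡ i }.

count : ∀ {n} → (Fin n → Bool) → ℕ
count {zero}  p = 0
count {suc n} p = (if p zero then 1 else 0) +ℕ count (λ i → p (suc i))

module _ {n m : ℕ} (col : Fin n → Fin n → Fin m) where

  Surjective : Set
  Surjective = ∀ (i : Fin m) → ∃ λ α → ∃ λ β → col α β ≡ i

  -- 1_Ω is a union of classes: a class meeting the diagonal lies in it
  DiagonalUnion : Set
  DiagonalUnion = ∀ (α β γ : Fin n) → col α α ≡ col β γ → β ≡ γ

  TransposeClosed : Set
  TransposeClosed = ∀ (i : Fin m) → ∃ λ (j : Fin m) →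
                      ∀ α β → (col α β ≡ i) ⇔ (col β α ≡ j)

  IsRainbow : Set
  IsRainbow = Surjective × DiagonalUnion × TransposeClosed

  N : Fin m → Fin m → Fin n → Fin n → ℕ
  N i j α β = count (λ γ → ⌊ col α γ ≟ᶠ i ⌋ ∧ ⌊ col γ β ≟ᶠ j ⌋)

  IsJordan : Set
  IsJordan = ∀ (i j : Fin m) (α β α' β' : Fin n) → col α β ≡ col α' β' →
               N i j α β +ℕ N j i α β ≡ N i j α' β' +ℕ N j i α' β'

  IsJordanConfiguration : Set
  IsJordanConfiguration = IsRainbow × IsJordan

  IsSymmetric : Set
  IsSymmetric = ∀ (α β : Fin n) → col α β ≡ col β α

  IsRegular : Set
  IsRegular = ∀ (i : Fin m) (α α' : Fin n) →
                count (λ γ → ⌊ col α γ ≟ᶠ i ⌋) ≡ count (λ γ → ⌊ col α' γ ≟ᶠ i ⌋)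

  IsHomogeneous : Set
  IsHomogeneous = ∃ λ (i : Fin m) → ∀ α β → (col α β ≡ i) ⇔ (α ≡ β)

-- For a symmetric colouring the Jordan sum for (C, C) at (α, α) is 2 |C(α)|; when
-- all diagonal pairs lie in one class this forces every valency |C(α)| to be
-- independent of α. Conversely, if the configuration is regular, every α has some β
-- with (α, β) in the class of a fixed diagonal pair, and since 1_Ω is a union of
-- classes β = α. For (c) and (d): A J and, for symmetric A, A ⋆ J are multiples of
-- J exactly when the row sums of A are constant, and the row sum of a class matrix
-- is its valency. In characteristic zero this turns (c) and (d) into regularity,
-- while the identity matrix, a class matrix of a homogeneous configuration, gives
-- F⟨J⟩ ⊆ 𝒜 J and F⟨J⟩ ⊆ 𝒜 ⋆ J.
module Submission where

open import Defs
open import Data.Nat using (ℕ; suc)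
open import Data.Fin using (Fin)
open import Data.Product using (_×_)
open import Function.Bundles using (_⇔_)

open import Level using (_⊔_)
open import Data.Nat using (zero) renaming (_+_ to _+ℕ_)
open import Data.Nat.Properties as ℕₚ using (1+n≢0; *-cancelˡ-≡)
open import Data.Fin using (zero; suc; punchIn) renaming (_≟_ to _≟ᶠ_)
open import Data.Fin.Properties using (punchInᵢ≢i)
open import Data.Bool using (Bool; true; false; if_then_else_; _∧_)
open import Data.Bool.Properties using (∧-idem)
open import Data.Product using (∃; _,_)
open import Data.Empty using (⊥-elim)
open import Data.Vec.Functional using (Vector)
open import Function.Base using (_∘_)
open import Function.Bundles using (mk⇔; Equivalence)
open import Relation.Nullary using (¬_; Dec; yes; no)
open import Relation.Nullary.Decidable using (⌊_⌋)
open import Relation.Binary.PropositionalEquality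
  using (_≡_; _≢_; _≗_; refl; sym; trans; cong; cong₂; subst; module ≡-Reasoning)
import Algebra.Properties.Group as GroupProperties
import Algebra.Properties.Semiring.Sum as SemiringSum
import Relation.Binary.Reasoning.Setoid as SetoidReasoning

module _ {a} {A : Set a} where

  ⌊⌋-yes : (d : Dec A) → A → ⌊ d ⌋ ≡ true
  ⌊⌋-yes (yes _) _ = refl
  ⌊⌋-yes (no ¬x) x = ⊥-elim (¬x x)

  ⌊⌋-no : (d : Dec A) → ¬ A → ⌊ d ⌋ ≡ false
  ⌊⌋-no (yes x) ¬x = ⊥-elim (¬x x)
  ⌊⌋-no (no _)  _  = refl

  ⌊⌋-true⇒ : (d : Dec A) → ⌊ d ⌋ ≡ true → A
  ⌊⌋-true⇒ (yes x) _ = x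

m+m≡n+n⇒m≡n : ∀ {m n} → m +ℕ m ≡ n +ℕ n → m ≡ n
m+m≡n+n⇒m≡n {m} {n} e = *-cancelˡ-≡ m n 2
  (trans (cong (m +ℕ_) (ℕₚ.+-identityʳ m)) (trans e (sym (cong (n +ℕ_) (ℕₚ.+-identityʳ n)))))

count-cong : ∀ {n} {p q : Fin n → Bool} → p ≗ q → count p ≡ count q
count-cong {zero}          e = refl
count-cong {suc n} {p} {q} e rewrite e zero =
  cong ((if q zero then 1 else 0) +ℕ_) (count-cong (e ∘ suc))

count-nonzero : ∀ {n} (p : Fin n → Bool) (γ : Fin n) → p γ ≡ true → count p ≢ 0
count-nonzero p zero    pγ c with p zero
count-nonzero p zero    () c | false
count-nonzero p zero    pγ () | true
count-nonzero p (suc γ) pγ c with p zero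
... | true  = 1+n≢0 c
... | false = count-nonzero (p ∘ suc) γ pγ c

count-witness : ∀ {n} (p : Fin n → Bool) → count p ≢ 0 → ∃ λ γ → p γ ≡ true
count-witness {zero}  p c≢0 = ⊥-elim (c≢0 refl)
count-witness {suc n} p c≢0 with p zero in p0
... | true  = zero , p0
... | false with count-witness (p ∘ suc) c≢0
...   | γ , pγ = suc γ , pγ

valency : ∀ {n m} → (Fin n → Fin n → Fin m) → Fin m → Fin n → ℕ
valency col i α = count (λ γ → ⌊ col α γ ≟ᶠ i ⌋)

N-diagonal : ∀ {n m} {col : Fin n → Fin n → Fin m} → IsSymmetric col →
             ∀ i α → N col i i α α ≡ valency col i α
N-diagonal {col = col} symmetric i α = count-cong λ γ →
  trans (cong (λ k → ⌊ col α γ ≟ᶠ i ⌋ ∧ ⌊ k ≟ᶠ i ⌋) (symmetric γ α)) (∧-idem _)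

regular⇒homogeneous : ∀ {n m} {col : Fin (suc n) → Fin (suc n) → Fin m} →
                      DiagonalUnion col → IsRegular col → IsHomogeneous col
regular⇒homogeneous {n} {col = col} diagonalUnion regular =
  i₀ , λ α β → mk⇔ (λ e → diagonalUnion zero α β (sym e)) (λ { refl → diagonal α })
  where
  i₀ = col zero zero

  inClass₀ : Fin (suc n) → Fin (suc n) → Bool
  inClass₀ α γ = ⌊ col α γ ≟ᶠ i₀ ⌋

  diagonal : ∀ α → col α α ≡ i₀
  diagonal α =
    let (γ , t) = count-witness (inClass₀ α)
          (count-nonzero (inClass₀ zero) zero (⌊⌋-yes (i₀ ≟ᶠ i₀) refl) ∘ trans (regular i₀ zero α))
        colαγ≡i₀ = ⌊⌋-true⇒ (col α γ ≟ᶠ i₀) t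
    in subst (λ δ → col α δ ≡ i₀) (sym (diagonalUnion zero α γ (sym colαγ≡i₀))) colαγ≡i₀

homogeneous⇒regular : ∀ {n m} {col : Fin n → Fin n → Fin m} →
                      IsJordan col → IsSymmetric col → IsHomogeneous col → IsRegular col
homogeneous⇒regular {col = col} jordan symmetric (i₀ , isDiagonal) k α α' =
  m+m≡n+n⇒m≡n (begin
    valency col k α  +ℕ valency col k α   ≡⟨ sym (cong₂ _+ℕ_ (Nkk α) (Nkk α)) ⟩
    N col k k α α    +ℕ N col k k α α     ≡⟨ jordan k k α α α' α' sameClass ⟩
    N col k k α' α'  +ℕ N col k k α' α'   ≡⟨ cong₂ _+ℕ_ (Nkk α') (Nkk α') ⟩
    valency col k α' +ℕ valency col k α'  ∎)
  where
  open ≡-Reasoning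
  Nkk = N-diagonal symmetric k
  sameClass : col α α ≡ col α' α'
  sameClass = trans (Equivalence.from (isDiagonal α α) refl)
                    (sym (Equivalence.from (isDiagonal α' α') refl))

module _ {c ℓ} (F : Field c ℓ) where
  open Field F hiding (refl; sym; trans; zero)
  open FieldDefs F
  open SemiringSum semiring using (sum; sum-cong-≋; sum-remove; sum-replicate-zero; ∑-comm; *-distribˡ-sum)
  open SetoidReasoning setoid
  private
    ≈-refl = Field.refl F
    ≈-sym = Field.sym F
    ≈-trans = Field.trans F

  sum-supported-at : ∀ {k} (f : Vector Carrier k) (i : Fin k) →
                     (∀ j → j ≢ i → f j ≈ 0#) → sum f ≈ f i
  sum-supported-at {suc k} f i vanishes = begin
    sum f                              ≈⟨ sum-remove f ⟩
    f i + sum (f ∘ punchIn i)          ≈⟨ +-congˡ (sum-cong-≋ (λ j → vanishes (punchIn i j) (punchInᵢ≢i i j))) ⟩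
    f i + sum {k} (λ _ → 0#)           ≈⟨ +-congˡ (sum-replicate-zero k) ⟩
    f i + 0#                           ≈⟨ +-identityʳ (f i) ⟩
    f i                                ∎

  Σᶠ≡sum : ∀ {k} (f : Vector Carrier k) → Σᶠ f ≡ sum f
  Σᶠ≡sum {zero}  f = refl
  Σᶠ≡sum {suc k} f = cong (f zero +_) (Σᶠ≡sum (f ∘ suc))

  sum-indicator : ∀ {k} (p : Fin k → Bool) → sum (λ γ → if p γ then 1# else 0#) ≈ fromℕ (count p)
  sum-indicator {zero}  p = ≈-refl
  sum-indicator {suc k} p with p zero
  ... | true  = +-congˡ (sum-indicator (p ∘ suc))
  ... | false = ≈-trans (+-identityˡ _) (sum-indicator (p ∘ suc))

  module _ (charZero : CharZero) where

    fromℕ-injective : ∀ {a b} → fromℕ a ≈ fromℕ b → a ≡ b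
    fromℕ-injective {zero}  {zero}  e = refl
    fromℕ-injective {zero}  {suc b} e = ⊥-elim (charZero b (≈-sym e))
    fromℕ-injective {suc a} {zero}  e = ⊥-elim (charZero a e)
    fromℕ-injective {suc a} {suc b} e =
      cong suc (fromℕ-injective (GroupProperties.∙-cancelˡ +-group 1# _ _ e))

    half-double : ∀ y → (1# + 1#) ⁻¹ * (y + y) ≈ y
    half-double y = begin
      (1# + 1#) ⁻¹ * (y + y)             ≈⟨ *-congˡ (+-cong (≈-sym (*-identityˡ y)) (≈-sym (*-identityˡ y))) ⟩
      (1# + 1#) ⁻¹ * (1# * y + 1# * y)   ≈⟨ *-congˡ (≈-sym (distribʳ y 1# 1#)) ⟩
      (1# + 1#) ⁻¹ * ((1# + 1#) * y)     ≈⟨ ≈-sym (*-assoc _ _ _) ⟩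
      ((1# + 1#) ⁻¹ * (1# + 1#)) * y     ≈⟨ *-congʳ (≈-trans (*-comm _ _) (inverseʳ _ two≉0)) ⟩
      1# * y                             ≈⟨ *-identityˡ y ⟩
      y                                  ∎
      where
      two≉0 : ¬ (1# + 1# ≈ 0#)
      two≉0 = charZero 1 ∘ ≈-trans (+-congˡ (+-identityʳ 1#))

  rowSum : ∀ {n} → Mat n → Fin n → Carrier
  rowSum A α = sum (A α)

  ·J≈rowSum : ∀ {n} (A : Mat n) α β → (A ·ₘ J) α β ≈ rowSum A α
  ·J≈rowSum A α β =
    ≈-trans (reflexive (Σᶠ≡sum (λ γ → A α γ * 1#))) (sum-cong-≋ (λ γ → *-identityʳ (A α γ)))

  J·≈rowSum : ∀ {n} (A : Mat n) → (∀ α β → A α β ≈ A β α) → ∀ α β → (J ·ₘ A) α β ≈ rowSum A β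
  J·≈rowSum A symmetric α β =
    ≈-trans (reflexive (Σᶠ≡sum (λ γ → 1# * A γ β)))
            (sum-cong-≋ (λ γ → ≈-trans (*-identityˡ _) (symmetric γ β)))

  ⋆J≈mean : ∀ {n} (A : Mat n) → (∀ α β → A α β ≈ A β α) →
            ∀ α β → (A ⋆ J) α β ≈ (1# + 1#) ⁻¹ * (rowSum A α + rowSum A β)
  ⋆J≈mean A symmetric α β = *-congˡ (+-cong (·J≈rowSum A α β) (J·≈rowSum A symmetric α β))

  single : ∀ {k} → Fin k → Carrier → Vector Carrier k
  single i x j = if ⌊ j ≟ᶠ i ⌋ then x else 0#

  sum-single : ∀ {k} (i : Fin k) x (v : Vector Carrier k) → Σᶠ (λ j → single i x j * v j) ≈ x * v i
  sum-single i x v = begin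
    Σᶠ (λ j → single i x j * v j)   ≡⟨ Σᶠ≡sum (λ j → single i x j * v j) ⟩
    sum (λ j → single i x j * v j)  ≈⟨ sum-supported-at _ i off-i ⟩
    single i x i * v i              ≡⟨ cong (λ b → (if b then x else 0#) * v i) (⌊⌋-yes (i ≟ᶠ i) refl) ⟩
    x * v i                         ∎
    where
    off-i : ∀ j → j ≢ i → single i x j * v j ≈ 0#
    off-i j j≢i = ≈-trans
      (*-congʳ (reflexive (cong (λ b → if b then x else 0#) (⌊⌋-no (j ≟ᶠ i) j≢i))))
      (zeroˡ (v j))

  module _ {n m : ℕ} (col : Fin n → Fin n → Fin m) where

    rowSum-adj : ∀ i α → rowSum (adj col i) α ≈ fromℕ (valency col i α)
    rowSum-adj i α = sum-indicator (λ γ → ⌊ col α γ ≟ᶠ i ⌋)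

    rowSum-InAlg : ∀ {A} → ((a , _) : InAlg col A) →
                   ∀ α → rowSum A α ≈ sum (λ i → a i * fromℕ (valency col i α))
    rowSum-InAlg {A} (a , A≈) α = begin
      sum (A α)
        ≈⟨ sum-cong-≋ (λ γ → ≈-trans (A≈ α γ) (reflexive (Σᶠ≡sum (λ i → a i * adj col i α γ)))) ⟩
      sum (λ γ → sum (λ i → a i * adj col i α γ))  ≈⟨ ∑-comm (λ γ i → a i * adj col i α γ) ⟩
      sum (λ i → sum (λ γ → a i * adj col i α γ))
        ≈⟨ sum-cong-≋ (λ i → ≈-sym (*-distribˡ-sum (a i) (adj col i α))) ⟩
      sum (λ i → a i * rowSum (adj col i) α)       ≈⟨ sum-cong-≋ (λ i → *-congˡ (rowSum-adj i α)) ⟩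
      sum (λ i → a i * fromℕ (valency col i α))    ∎

    regular⇒rowSum-constant : IsRegular col → ∀ {A} → InAlg col A → ∀ α α' → rowSum A α ≈ rowSum A α'
    regular⇒rowSum-constant regular {A} (a , A≈) α α' = begin
      rowSum A α                                  ≈⟨ rowSum-InAlg (a , A≈) α ⟩
      sum (λ i → a i * fromℕ (valency col i α))
        ≈⟨ sum-cong-≋ (λ i → *-congˡ (reflexive (cong fromℕ (regular i α α')))) ⟩
      sum (λ i → a i * fromℕ (valency col i α'))  ≈⟨ rowSum-InAlg (a , A≈) α' ⟨
      rowSum A α'                                 ∎

    InAlg-symmetric : IsSymmetric col → ∀ {A} → InAlg col A → ∀ α β → A α β ≈ A β α
    InAlg-symmetric symmetric {A} (a , A≈) α β = begin
      A α β                                   ≈⟨ A≈ α β ⟩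
      Σᶠ (λ i → a i * adj col i α β)
        ≡⟨ cong (λ k → Σᶠ (λ i → a i * (if ⌊ k ≟ᶠ i ⌋ then 1# else 0#))) (symmetric α β) ⟩
      Σᶠ (λ i → a i * adj col i β α)          ≈⟨ A≈ β α ⟨
      A β α                                   ∎

    scaled-adj∈Alg : ∀ x i → InAlg col (x •ₘ adj col i)
    scaled-adj∈Alg x i = single i x , λ α β → ≈-sym (sum-single i x (λ j → adj col j α β))

    adj∈Alg : ∀ i → InAlg col (adj col i)
    adj∈Alg i = single i 1# , λ α β →
      ≈-sym (≈-trans (sum-single i 1# (λ j → adj col j α β)) (*-identityˡ _))

    rowSum-scaled-diagonal : ((i₀ , _) : IsHomogeneous col) → ∀ x α → rowSum (x •ₘ adj col i₀) α ≈ x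
    rowSum-scaled-diagonal (i₀ , isDiagonal) x α = begin
      sum (λ γ → x * adj col i₀ α γ)  ≈⟨ sum-supported-at _ α off-diagonal ⟩
      x * adj col i₀ α α
        ≡⟨ cong (λ b → x * (if b then 1# else 0#))
                (⌊⌋-yes (col α α ≟ᶠ i₀) (Equivalence.from (isDiagonal α α) refl)) ⟩
      x * 1#                          ≈⟨ *-identityʳ x ⟩
      x                               ∎
      where
      off-diagonal : ∀ γ → γ ≢ α → x * adj col i₀ α γ ≈ 0#
      off-diagonal γ γ≢α = ≈-trans
        (*-congˡ (reflexive (cong (λ b → if b then 1# else 0#)
          (⌊⌋-no (col α γ ≟ᶠ i₀) (γ≢α ∘ sym ∘ Equivalence.to (isDiagonal α γ))))))
        (zeroʳ x)

  ·J-constant : ∀ {n} (A : Mat n) x → (∀ α → rowSum A α ≈ x) → (A ·ₘ J) ≈ₘ (x •ₘ J)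
  ·J-constant A x rows α β = ≈-trans (·J≈rowSum A α β) (≈-trans (rows α) (≈-sym (*-identityʳ x)))

  module _ (charZero : CharZero) {n} {A : Mat n} (symmetric : ∀ α β → A α β ≈ A β α) where

    ⋆J-constant : ∀ x → (∀ α → rowSum A α ≈ x) → (A ⋆ J) ≈ₘ (x •ₘ J)
    ⋆J-constant x rows α β = begin
      (A ⋆ J) α β                              ≈⟨ ⋆J≈mean A symmetric α β ⟩
      (1# + 1#) ⁻¹ * (rowSum A α + rowSum A β) ≈⟨ *-congˡ (+-cong (rows α) (rows β)) ⟩
      (1# + 1#) ⁻¹ * (x + x)                   ≈⟨ half-double charZero x ⟩
      x                                        ≈⟨ *-identityʳ x ⟨
      x * 1#                                   ∎

    ⋆J-diagonal : ∀ α → (A ⋆ J) α α ≈ rowSum A α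
    ⋆J-diagonal α = ≈-trans (⋆J≈mean A symmetric α α) (half-double charZero (rowSum A α))

  -- AlgTimesJ col and AlgStarJ col are, definitionally, AlgImage col (_·ₘ J) and AlgImage col (_⋆ J).
  AlgImage : ∀ {n m} → (Fin n → Fin n → Fin m) → (Mat n → Mat n) → Mat n → Set (c ⊔ ℓ)
  AlgImage col Φ M = ∃ λ A → InAlg col A × (M ≈ₘ Φ A)

  module _ (charZero : CharZero) {n m} {col : Fin (suc n) → Fin (suc n) → Fin m}
           (regular⇔homogeneous : IsRegular col ⇔ IsHomogeneous col)
           (Φ : Mat (suc n) → Mat (suc n))
           (Φ-constant : ∀ {A} x → InAlg col A → (∀ α → rowSum A α ≈ x) → Φ A ≈ₘ (x •ₘ J))
           (Φ-diagonal : ∀ {A} → InAlg col A → ∀ α → Φ A α α ≈ rowSum A α) where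

    homogeneous⇔AlgImage≐SpanJ : IsHomogeneous col ⇔ (AlgImage col Φ ≐ SpanJ)
    homogeneous⇔AlgImage≐SpanJ = mk⇔ AlgImage≐SpanJ homogeneous
      where
      AlgImage≐SpanJ : IsHomogeneous col → AlgImage col Φ ≐ SpanJ
      AlgImage≐SpanJ hom@(i₀ , _) M = mk⇔
        (λ (A , A∈ , M≈ΦA) → rowSum A zero , λ α β →
          ≈-trans (M≈ΦA α β) (Φ-constant _ A∈ (λ α → regular⇒rowSum-constant col regular A∈ α zero) α β))
        (λ (x , M≈xJ) → x •ₘ adj col i₀ , scaled-adj∈Alg col x i₀ , λ α β →
          ≈-trans (M≈xJ α β)
            (≈-sym (Φ-constant x (scaled-adj∈Alg col x i₀) (rowSum-scaled-diagonal col hom x) α β)))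
        where
        regular = Equivalence.from regular⇔homogeneous hom

      homogeneous : AlgImage col Φ ≐ SpanJ → IsHomogeneous col
      homogeneous AlgImage≐SpanJ = Equivalence.to regular⇔homogeneous λ i α α' →
        let (x , ΦCᵢ≈xJ) = Equivalence.to (AlgImage≐SpanJ (Φ (adj col i)))
                                          (adj col i , adj∈Alg col i , λ _ _ → ≈-refl)
        in fromℕ-injective charZero (begin
          fromℕ (valency col i α)   ≈⟨ rowSum-adj col i α ⟨
          rowSum (adj col i) α      ≈⟨ Φ-diagonal (adj∈Alg col i) α ⟨
          Φ (adj col i) α α         ≈⟨ ΦCᵢ≈xJ α α ⟩
          x * 1#                    ≈⟨ ΦCᵢ≈xJ α' α' ⟨
          Φ (adj col i) α' α'       ≈⟨ Φ-diagonal (adj∈Alg col i) α' ⟩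
          rowSum (adj col i) α'     ≈⟨ rowSum-adj col i α' ⟩
          fromℕ (valency col i α')  ∎)

proposition2p3 : ∀ {c ℓ} (F : Field c ℓ) → FieldDefs.CharZero F →
    (n m : ℕ) (col : Fin (suc n) → Fin (suc n) → Fin m) →
    IsJordanConfiguration col → IsSymmetric col →
    (IsRegular col ⇔ IsHomogeneous col)
    × (IsHomogeneous col ⇔ FieldDefs._≐_ F (FieldDefs.AlgTimesJ F col) (FieldDefs.SpanJ F))
    × (IsHomogeneous col ⇔ FieldDefs._≐_ F (FieldDefs.AlgStarJ F col) (FieldDefs.SpanJ F))
proposition2p3 F charZero n m col ((_ , diagonalUnion , _) , jordan) symmetric =
  regular⇔homogeneous ,
  homogeneous⇔AlgImage≐SpanJ F charZero regular⇔homogeneous (_·ₘ J)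
    (λ {A} x _ → ·J-constant F A x) (λ {A} _ α → ·J≈rowSum F A α α) ,
  homogeneous⇔AlgImage≐SpanJ F charZero regular⇔homogeneous (_⋆ J)
    (λ x A∈ → ⋆J-constant F charZero (InAlg-symmetric F col symmetric A∈) x)
    (λ A∈ → ⋆J-diagonal F charZero (InAlg-symmetric F col symmetric A∈))
  where
  open FieldDefs F using (J; _·ₘ_; _⋆_)
  regular⇔homogeneous : IsRegular col ⇔ IsHomogeneous col
  regular⇔homogeneous = mk⇔ (regular⇒homogeneous diagonalUnion) (homogeneous⇒regular jordan symmetric)
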